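{- Let $\Lambda$ be a numerical semigroup with enumeration $\lambda$, genus $g$ and conductor $c$ (so that $\lambda_0,\dots,\lambda_{c-g-1}$ are exactly the elements of $\Lambda$ smaller than $c$), and let $d=\gcd(\lambda_0,\dots,\lambda_{c-g-1})$. Then: (1) $\Lambda$ lies in an infinite chain if and only if $d\neq 1$. (2) If $d=1$, then the descendant of $\Lambda$ of largest genus is the numerical semigroup generated by $\lambda_0,\dots,\lambda_{c-g-1}$. (3) If $d\neq 1$, then $\Lambda$ lies in infinitely many infinite chains if and only if $d$ is not prime.
   Context: A numerical semigroup is a subset $\Lambda\subseteq\mathbb{N}_0$ containing $0$, closed under addition, with finite complement; the gaps are the elements of $\mathbb{N}_0\setminus\Lambda$, the genus $g$ is their number, the conductor $c$ is the smallest integer such that all integers $\geq c$ lie in $\Lambda$, and the Frobenius number is $c-1$. The enumeration is the increasing bijection $\lambda:\mathbb{N}_0\to\Lambda$, $i\mapsto\lambda_i$. The gcd of a list consisting only of $0$ is $0$. Generators are the elements of the minimal generating set. The semigroup tree has root $\mathbb{N}_0$, and the children of a node $\Lambda$ are the semigroups $\Lambda\setminus\{x\}$ for $x$ a generator of $\Lambda$ with $x\geq c$ (equivalently, the parent of a semigroup $\neq\mathbb{N}_0$ is obtained by adding its Frobenius number). The descendants of $\Lambda$ are the semigroups in the subtree rooted at $\Lambda$ ($\Lambda$ itself included). An infinite chain is an infinite sequence $\Lambda_0=\mathbb{N}_0,\Lambda_1,\Lambda_2,\dots$ of numerical semigroups such that for every $i\geq1$, $\Lambda_{i-1}$ is obtained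 by adding to $\Lambda_i$ its Frobenius number; $\Lambda$ lies in the chain if $\Lambda=\Lambda_i$ for some $i$. -}

module Defs where

open import Data.Nat using (ℕ; zero; suc; _+_; _≤_; _<_; _≡ᵇ_)
open import Data.Nat.GCD using (gcd)
open import Data.Bool using (Bool; true; false; _∨_; not)
open import Data.List using (List; []; _∷_; foldr; filterᵇ; upTo; length)
open import Data.List.Membership.Propositional using (_∈_)
open import Data.Product using (Σ; _×_; _,_)
open import Relation.Binary.PropositionalEquality using (_≡_; _≢_)
open import Relation.Nullary using (¬_)

record NumericalSemigroup : Set where
  field
    mem       : ℕ → Bool
    mem-zero  : mem 0 ≡ true
    mem-add   : ∀ a b → mem a ≡ true → mem b ≡ true → mem (a + b) ≡ true
    bound     : ℕ
    bound-ok  : ∀ n → bound ≤ n → mem n ≡ true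

open NumericalSemigroup public

_≈_ : NumericalSemigroup → NumericalSemigroup → Set
Λ ≈ Λ' = ∀ n → mem Λ n ≡ mem Λ' n

IsN₀ : NumericalSemigroup → Set
IsN₀ Λ = ∀ n → mem Λ n ≡ true

IsConductor : NumericalSemigroup → ℕ → Set
IsConductor Λ c =
  (∀ n → c ≤ n → mem Λ n ≡ true) ×
  (∀ c' → (∀ n → c' ≤ n → mem Λ n ≡ true) → c ≤ c')

-- F is the Frobenius number (= conductor - 1; only exists when Λ ≠ ℕ₀).
IsFrobenius : NumericalSemigroup → ℕ → Set
IsFrobenius Λ F = IsConductor Λ (suc F)

-- Genus: the number of gaps (all gaps are < bound).
genus : NumericalSemigroup → ℕ
genus Λ = length (filterᵇ (λ n → not (mem Λ n)) (upTo (bound Λ)))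

-- The elements of Λ smaller than c, in increasing order
-- (for c the conductor these are λ₀, …, λ_{c-g-1}).
elemsBelow : NumericalSemigroup → ℕ → List ℕ
elemsBelow Λ c = filterᵇ (mem Λ) (upTo c)

-- gcd of a list (gcd of the empty list / of [0] is 0).
gcdList : List ℕ → ℕ
gcdList = foldr gcd 0

data Generated (L : List ℕ) : ℕ → Set where
  gen-zero : Generated L 0
  gen-add  : ∀ {x n} → x ∈ L → Generated L n → Generated L (x + n)

-- P is obtained from C by adding to C its Frobenius number
-- (i.e. P is the parent of C in the semigroup tree; C is a child of P).
AddFrob : NumericalSemigroup → NumericalSemigroup → Set
AddFrob C P = Σ ℕ λ F → IsFrobenius C F × (∀ n → mem P n ≡ (mem C n ∨ (n ≡ᵇ F)))

data Descendant (Λ : NumericalSemigroup) : NumericalSemigroup → Set where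
  desc-self  : ∀ {D} → D ≈ Λ → Descendant Λ D
  desc-child : ∀ {P D} → Descendant Λ P → AddFrob D P → Descendant Λ D

InfiniteChain : Set
InfiniteChain = Σ (ℕ → NumericalSemigroup) λ C →
  IsN₀ (C 0) × (∀ i → AddFrob (C (suc i)) (C i))

chainAt : InfiniteChain → ℕ → NumericalSemigroup
chainAt (C , _) = C

LiesIn : NumericalSemigroup → InfiniteChain → Set
LiesIn Λ ch = Σ ℕ λ i → chainAt ch i ≈ Λ

SameChain : InfiniteChain → InfiniteChain → Set
SameChain ch ch' = ∀ i → chainAt ch i ≈ chainAt ch' i

LiesInSomeChain : NumericalSemigroup → Set
LiesInSomeChain Λ = Σ InfiniteChain (LiesIn Λ)

LiesInInfinitelyManyChains : NumericalSemigroup → Set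
LiesInInfinitelyManyChains Λ =
  Σ (ℕ → InfiniteChain) λ f →
    (∀ k → LiesIn Λ (f k)) × (∀ j k → j ≢ k → ¬ SameChain (f j) (f k))

module Submission where

-- A chain through Λ continues by removing Frobenius numbers, so its later members agree with Λ
-- below c, have ever larger conductors, and all contain the submonoid generated by the small
-- elements λ₀, …, λ_{c-g-1}; for d = 1 that submonoid is cofinite and bounds the conductors.
-- Conversely, for e ∣ d with e ≥ 2 the semigroups (Λ ∩ e ℕ) ∪ [t, ∞) form a chain through Λ,
-- each step removing the next non-multiple of e. The descendants of Λ are exactly the numerical
-- semigroups agreeing with Λ below c, so for d = 1 the semigroup generated by the small elements
-- is the descendant of largest genus. For d = a b with a, b ≥ 2, replacing e ℕ by
-- a b ℕ ∪ (a ℕ ∩ [T, ∞)) for infinitely many thresholds T gives distinct chains. For d prime,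
-- every later member of a chain through Λ has only multiples of d below its conductor, leaving
-- a binary choice at each step that is forced once the conductor passes the cofiniteness bound.

open import Defs
open import Data.Bool using (Bool; true; false; _∨_; _∧_; not; T; T?)
open import Data.Bool.Properties using (∨-assoc; ∨-identityʳ; ∧-zeroʳ; not-injective; T-≡; T-∧)
open import Data.Empty using (⊥-elim)
open import Data.List using (List; []; _∷_; _++_; [_]; filterᵇ; upTo; length)
open import Data.List.Properties using (upTo-∷ʳ; filter-++; filter-reject; ++-identityʳ)
open import Data.Bool.ListAction using (any)
open import Data.List.Membership.Propositional using (_∈_; find; lose)
open import Data.List.Membership.Propositional.Properties using (∈-upTo⁺; ∈-upTo⁻; ∈-filter⁺; ∈-filter⁻)
open import Data.List.Relation.Unary.Any using (here; there)
open import Data.List.Relation.Unary.Any.Properties using (any⁺; any⁻)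
open import Data.Nat
open import Data.Nat.Properties
open import Data.Nat.Divisibility
open import Data.Nat.DivMod using (_/_; _%_; m≡m%n+[m/n]*n; m%n<n)
open import Data.Nat.Primality using (Prime; ¬prime⇒composite; prime⇒irreducible; prime⇒nonTrivial)
open import Data.Nat.Divisibility.Core using (hasNonTrivialDivisor)
open import Data.Nat.GCD using (gcd; gcd[m,n]∣m; gcd[m,n]∣n; gcd-greatest; gcd-GCD; module Bézout)
open import Data.Nat.Tactic.RingSolver using (solve-∀)
open import Data.Product using (Σ; ∃; _×_; _,_; proj₁; proj₂)
open import Data.Sum using (_⊎_; inj₁; inj₂)
open import Data.Fin using (Fin; toℕ; fromℕ<; funToFin; finToFun)
open import Data.Fin.Properties using (pigeonhole; toℕ-fromℕ<; finToFun-funToFin)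
open import Function using (_∘_)
open import Function.Bundles using (_⇔_; mk⇔; Equivalence)
open import Relation.Binary.PropositionalEquality using (_≡_; _≢_; refl; sym; trans; cong; cong₂; subst; subst₂; module ≡-Reasoning)
open import Relation.Nullary using (¬_; Dec; yes; no; does)
open import Relation.Nullary.Decidable using (dec-true; dec-false)
open import Relation.Binary.Definitions using (tri<; tri≈; tri>)

private variable
  A : Set
  X Y Z C C′ P P′ : NumericalSemigroup
  γ γ′ : ℕ
  a b : Bool
  L : List ℕ

does⇒ : (a? : Dec A) → does a? ≡ true → A
does⇒ (yes a) _ = a

∨-trueˡ : a ≡ true → a ∨ b ≡ true
∨-trueˡ refl = refl

∨-trueʳ : b ≡ true → a ∨ b ≡ true
∨-trueʳ {a = true}  _ = refl
∨-trueʳ {a = false} e = e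

∨-true⁻ : a ∨ b ≡ true → a ≡ true ⊎ b ≡ true
∨-true⁻ {a = true}  _ = inj₁ refl
∨-true⁻ {a = false} e = inj₂ e

∧-true : a ≡ true → b ≡ true → a ∧ b ≡ true
∧-true refl e = e

∧-true⁻ : a ∧ b ≡ true → a ≡ true × b ≡ true
∧-true⁻ {a = true} e = refl , e

true≢false : true ≢ false
true≢false ()

-- The submonoid generated by a list

Generated-∈ : ∀ {x} → x ∈ L → Generated L x
Generated-∈ {x = x} x∈L = subst (Generated _) (+-identityʳ x) (gen-add x∈L gen-zero)

Generated-+ : ∀ {m n} → Generated L m → Generated L n → Generated L (m + n)
Generated-+ gen-zero g = g
Generated-+ {n = n} (gen-add {x} {m} x∈L g) g′ =
  subst (Generated _) (sym (+-assoc x m n)) (gen-add x∈L (Generated-+ g g′))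

Generated-* : ∀ k {n} → Generated L n → Generated L (k * n)
Generated-* zero    g = gen-zero
Generated-* (suc k) g = Generated-+ g (Generated-* k g)

Generated-∷ : ∀ {x n} → Generated L n → Generated (x ∷ L) n
Generated-∷ gen-zero = gen-zero
Generated-∷ (gen-add x∈L g) = gen-add (there x∈L) (Generated-∷ g)

Generated-⊆ : (X : NumericalSemigroup) → (∀ {x} → x ∈ L → mem X x ≡ true) →
              ∀ {n} → Generated L n → mem X n ≡ true
Generated-⊆ X L⊆X gen-zero = mem-zero X
Generated-⊆ X L⊆X (gen-add {x} {n} x∈L g) = mem-add X x n (L⊆X x∈L) (Generated-⊆ X L⊆X g)

Generated-∣ : ∀ {k} → (∀ {x} → x ∈ L → k ∣ x) → ∀ {n} → Generated L n → k ∣ n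
Generated-∣ k∣L gen-zero = _ ∣0
Generated-∣ k∣L (gen-add x∈L g) = ∣m∣n⇒∣m+n (k∣L x∈L) (Generated-∣ k∣L g)

gcdList-∣ : ∀ {x} → x ∈ L → gcdList L ∣ x
gcdList-∣ {a ∷ L} (here refl) = gcd[m,n]∣m a (gcdList L)
gcdList-∣ {a ∷ L} (there x∈L) = ∣-trans (gcd[m,n]∣n a (gcdList L)) (gcdList-∣ x∈L)

gcdList-greatest : ∀ {k} L → (∀ {x} → x ∈ L → k ∣ x) → k ∣ gcdList L
gcdList-greatest []      k∣L = _ ∣0
gcdList-greatest (a ∷ L) k∣L = gcd-greatest (k∣L (here refl)) (gcdList-greatest L (k∣L ∘ there))

-- Bézout's identity, read inside the generated submonoid.
Generated-gcdList-apart : ∀ L → ∃ λ N → Generated L N × Generated L (N + gcdList L)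
Generated-gcdList-apart [] = 0 , gen-zero , gen-zero
Generated-gcdList-apart (a ∷ L) with Generated-gcdList-apart L | Bézout.identity (gcd-GCD a (gcdList L))
... | N , gN , gN+g′ | Bézout.+- x y eq =
  y * (N + g′) , Generated-* y (Generated-∷ gN+g′) ,
  subst (Generated _) shift (Generated-+ (Generated-* x (Generated-∈ (here refl))) (Generated-* y (Generated-∷ gN)))
  where
  g′ = gcdList L
  shift : x * a + y * N ≡ y * (N + g′) + gcd a g′
  shift = trans (cong (_+ y * N) (sym eq)) (lemma (gcd a g′) y g′ N)
    where lemma : ∀ g y g′ N → g + y * g′ + y * N ≡ y * (N + g′) + g
          lemma = solve-∀
... | N , gN , gN+g′ | Bézout.-+ x y eq =
  x * a + y * N , Generated-+ (Generated-* x (Generated-∈ (here refl))) (Generated-* y (Generated-∷ gN)) ,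
  subst (Generated _) shift (Generated-* y (Generated-∷ gN+g′))
  where
  g′ = gcdList L
  shift : y * (N + g′) ≡ x * a + y * N + gcd a g′
  shift = trans (*-distribˡ-+ y N g′) (trans (cong (y * N +_) (sym eq)) (lemma (gcd a g′) x a y N))
    where lemma : ∀ g x a y N → y * N + (g + x * a) ≡ x * a + y * N + g
          lemma = solve-∀

combination-of-consecutive : ∀ q r → q * q ≤ r → ∃ λ u → ∃ λ v → u * q + v * suc q ≡ r
combination-of-consecutive q r q²≤r = w , s + t , (begin
  w * q + (s + t) * suc q                    ≡⟨ cong (λ x → w * x + (s + t) * suc x) q≡s+w ⟩
  w * (s + w) + (s + t) * suc (s + w)        ≡⟨ identity s w t ⟩
  (s + w) * (s + w) + (s + t * suc (s + w))  ≡⟨ cong (λ x → x * x + (s + t * suc x)) (sym q≡s+w) ⟩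
  q * q + (s + t * suc q)                    ≡⟨ cong (q * q +_) (sym (m≡m%n+[m/n]*n n (suc q))) ⟩
  q * q + n                                  ≡⟨ m+[n∸m]≡n q²≤r ⟩
  r                                          ∎)
  where
  open ≡-Reasoning
  n = r ∸ q * q
  s = n % suc q
  t = n / suc q
  w = q ∸ s
  q≡s+w : q ≡ s + w
  q≡s+w = sym (m+[n∸m]≡n (≤-pred (m%n<n n (suc q))))
  identity : ∀ s w t → w * (s + w) + (s + t) * suc (s + w) ≡ (s + w) * (s + w) + (s + t * suc (s + w))
  identity = solve-∀

Generated-multiples : ∀ q g → Generated L (q * g) → Generated L (suc q * g) →
                      ∀ m → g * (q * q) ≤ m → g ∣ m → Generated L m
Generated-multiples q zero _ _ _ _ (divides r refl) = subst (Generated _) (sym (*-zeroʳ r)) gen-zero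
Generated-multiples q g@(suc _) gq gsq _ gq²≤m (divides r refl)
  with combination-of-consecutive q r (*-cancelˡ-≤ g (subst (g * (q * q) ≤_) (*-comm r g) gq²≤m))
... | u , v , refl = subst (Generated _) (sym distribute) (Generated-+ (Generated-* u gq) (Generated-* v gsq))
  where
  distribute : (u * q + v * suc q) * g ≡ u * (q * g) + v * (suc q * g)
  distribute = trans (*-distribʳ-+ g (u * q) (v * suc q)) (cong₂ _+_ (*-assoc u q g) (*-assoc v (suc q) g))

Generated-cofinite : ∀ L → ∃ λ R → ∀ m → gcdList L * R ≤ m → gcdList L ∣ m → Generated L m
Generated-cofinite L with Generated-gcdList-apart L
... | N , gN , gN+g with Generated-∣ gcdList-∣ gN
... | divides q refl =
  q * q , Generated-multiples q (gcdList L) gN (subst (Generated L) (+-comm (q * gcdList L) (gcdList L)) gN+g)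

Generated-coprime-cofinite : ∀ L → gcdList L ≡ 1 → ∃ λ R → ∀ n → R ≤ n → Generated L n
Generated-coprime-cofinite L gcd≡1 with Generated-cofinite L
... | R , cofinite = R , λ n R≤n →
  cofinite n (subst (_≤ n) (sym (trans (cong (_* R) gcd≡1) (*-identityˡ R))) R≤n) (subst (_∣ n) (sym gcd≡1) (1∣ n))

-- A nonzero generated number starts with a positive generator x ≤ n; the fuel k bounds the search depth.
generatedᵇ-search : List ℕ → ℕ → ℕ → Bool
generatedᵇ-search L zero    n       = n ≡ᵇ 0
generatedᵇ-search L (suc k) zero    = true
generatedᵇ-search L (suc k) (suc m) = any startsWith L
  where
  startsWith : ℕ → Bool
  startsWith x = (1 ≤ᵇ x) ∧ (x ≤ᵇ suc m) ∧ generatedᵇ-search L k (suc m ∸ x)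

generatedᵇ : List ℕ → ℕ → Bool
generatedᵇ L n = generatedᵇ-search L n n

generatedᵇ-search-sound : ∀ k n → T (generatedᵇ-search L k n) → Generated L n
generatedᵇ-search-sound zero    n       t = subst (Generated _) (sym (≡ᵇ⇒≡ n 0 t)) gen-zero
generatedᵇ-search-sound (suc k) zero    _ = gen-zero
generatedᵇ-search-sound {L} (suc k) (suc m) t with find (any⁻ _ L t)
... | x , x∈L , tx with Equivalence.to (T-∧ {1 ≤ᵇ x}) tx
... | _ , rest with Equivalence.to (T-∧ {x ≤ᵇ suc m}) rest
... | x≤n , tg = subst (Generated L) (m+[n∸m]≡n (≤ᵇ⇒≤ x (suc m) x≤n))
                   (gen-add x∈L (generatedᵇ-search-sound k (suc m ∸ x) tg))

generatedᵇ-search-complete : ∀ {n} → Generated L n → ∀ k → n ≤ k → T (generatedᵇ-search L k n)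
generatedᵇ-search-complete gen-zero zero    _ = _
generatedᵇ-search-complete gen-zero (suc k) _ = _
generatedᵇ-search-complete (gen-add {zero} _ g) k n≤k = generatedᵇ-search-complete g k n≤k
generatedᵇ-search-complete {L} (gen-add {suc x} {n} x∈L g) (suc k) (s≤s n≤k) =
  any⁺ _ (lose x∈L (Equivalence.from (T-∧ {1 ≤ᵇ suc x}) (_ ,
    Equivalence.from (T-∧ {suc x ≤ᵇ suc (x + n)}) (≤⇒≤ᵇ (s≤s (m≤m+n x n)) , rest-generated))))
  where
  rest-generated : T (generatedᵇ-search L k (x + n ∸ x))
  rest-generated = subst (T ∘ generatedᵇ-search L k) (sym (m+n∸m≡n x n))
                         (generatedᵇ-search-complete g k (≤-trans (m≤n+m n x) n≤k))

generatedᵇ-true⇔ : ∀ n → (generatedᵇ L n ≡ true) ⇔ Generated L n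
generatedᵇ-true⇔ n = mk⇔ (generatedᵇ-search-sound n n ∘ Equivalence.from T-≡)
                         (λ g → Equivalence.to T-≡ (generatedᵇ-search-complete g n ≤-refl))

∈-elemsBelow⁺ : ∀ {n c} → mem X n ≡ true → n < c → n ∈ elemsBelow X c
∈-elemsBelow⁺ {X} n∈X n<c = ∈-filter⁺ (T? ∘ mem X) (∈-upTo⁺ n<c) (Equivalence.from T-≡ n∈X)

∈-elemsBelow⁻ : ∀ {n c} → n ∈ elemsBelow X c → mem X n ≡ true × n < c
∈-elemsBelow⁻ {X} n∈E with ∈-filter⁻ (T? ∘ mem X) n∈E
... | n∈upTo , t = Equivalence.to T-≡ t , ∈-upTo⁻ n∈upTo

-- Gaps and genus

length-filterᵇ-mono : {p q : A → Bool} → (∀ {x} → p x ≡ true → q x ≡ true) →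
                      ∀ xs → length (filterᵇ p xs) ≤ length (filterᵇ q xs)
length-filterᵇ-mono p⇒q [] = z≤n
length-filterᵇ-mono {p = p} {q} p⇒q (x ∷ xs) with p x in px | q x in qx
... | true  | true  = s≤s (length-filterᵇ-mono p⇒q xs)
... | true  | false = ⊥-elim (true≢false (trans (sym (p⇒q px)) qx))
... | false | true  = m≤n⇒m≤1+n (length-filterᵇ-mono p⇒q xs)
... | false | false = length-filterᵇ-mono p⇒q xs

length-filterᵇ-≡ : {p q : A → Bool} → (∀ {x} → p x ≡ true → q x ≡ true) →
                   ∀ xs → length (filterᵇ p xs) ≡ length (filterᵇ q xs) → ∀ {x} → x ∈ xs → p x ≡ q x
length-filterᵇ-≡ {p = p} {q} p⇒q (y ∷ xs) eq x∈ with p y in py | q y in qy | x∈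
... | true  | true  | here refl = trans py (sym qy)
... | true  | true  | there x∈xs = length-filterᵇ-≡ p⇒q xs (suc-injective eq) x∈xs
... | true  | false | _ = ⊥-elim (true≢false (trans (sym (p⇒q py)) qy))
... | false | true  | _ = ⊥-elim (1+n≰n (≤-trans (≤-reflexive (sym eq)) (length-filterᵇ-mono p⇒q xs)))
... | false | false | here refl = trans py (sym qy)
... | false | false | there x∈xs = length-filterᵇ-≡ p⇒q xs eq x∈xs

gapCount : NumericalSemigroup → ℕ → ℕ
gapCount X M = length (filterᵇ (not ∘ mem X) (upTo M))

gapCount-suc : ∀ {M} → mem X M ≡ true → gapCount X (suc M) ≡ gapCount X M
gapCount-suc {X} {M} M∈X = begin
  length (filterᵇ gap (upTo (suc M)))                 ≡⟨ cong (length ∘ filterᵇ gap) (sym (upTo-∷ʳ M)) ⟩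
  length (filterᵇ gap (upTo M ++ [ M ]))              ≡⟨ cong length (filter-++ (T? ∘ gap) (upTo M) [ M ]) ⟩
  length (filterᵇ gap (upTo M) ++ filterᵇ gap [ M ])  ≡⟨ cong (λ l → length (filterᵇ gap (upTo M) ++ l)) M-rejected ⟩
  length (filterᵇ gap (upTo M) ++ [])                 ≡⟨ cong length (++-identityʳ (filterᵇ gap (upTo M))) ⟩
  length (filterᵇ gap (upTo M))                       ∎
  where
  open ≡-Reasoning
  gap = not ∘ mem X
  M-rejected : filterᵇ gap [ M ] ≡ []
  M-rejected = filter-reject (T? ∘ gap) (subst (T ∘ not) M∈X)

genus≡gapCount : ∀ {M} → bound X ≤ M → genus X ≡ gapCount X M
genus≡gapCount {X} b≤M = go (≤⇒≤′ b≤M)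
  where
  go : ∀ {M} → bound X ≤′ M → genus X ≡ gapCount X M
  go ≤′-refl = refl
  go (≤′-step {M} b≤′M) = trans (go b≤′M) (sym (gapCount-suc {X} (bound-ok X M (≤′⇒≤ b≤′M))))

genus-antitone : (∀ {n} → mem X n ≡ true → mem Y n ≡ true) →
                 genus Y ≤ genus X × (genus Y ≡ genus X → Y ≈ X)
genus-antitone {X} {Y} X⊆Y =
  subst₂ _≤_ (sym gY) (sym gX) (length-filterᵇ-mono gap⇒gap (upTo M)) ,
  λ eq → same-on-gaps (trans (sym gY) (trans eq gX))
  where
  M = bound X + bound Y
  gX = genus≡gapCount {X} (m≤m+n (bound X) (bound Y))
  gY = genus≡gapCount {Y} (m≤n+m (bound Y) (bound X))
  gap⇒gap : ∀ {n} → not (mem Y n) ≡ true → not (mem X n) ≡ true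
  gap⇒gap {n} ny with mem X n in xn
  ... | false = refl
  ... | true  = subst (λ b → not b ≡ true) (X⊆Y xn) ny
  same-on-gaps : gapCount Y M ≡ gapCount X M → Y ≈ X
  same-on-gaps eq n with n <? M
  ... | yes n<M = not-injective (length-filterᵇ-≡ gap⇒gap (upTo M) eq (∈-upTo⁺ n<M))
  ... | no n≮M  = trans (bound-ok Y n (≤-trans (m≤n+m _ _) (≮⇒≥ n≮M)))
                        (sym (bound-ok X n (≤-trans (m≤m+n _ _) (≮⇒≥ n≮M))))

-- Conductors and the parent map

≈-sym : X ≈ Y → Y ≈ X
≈-sym X≈Y n = sym (X≈Y n)

≈-trans : X ≈ Y → Y ≈ Z → X ≈ Z
≈-trans X≈Y Y≈Z n = trans (X≈Y n) (Y≈Z n)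

IsConductor-unique : IsConductor X γ → IsConductor X γ′ → γ ≡ γ′
IsConductor-unique (γ-ok , γ-least) (γ′-ok , γ′-least) = ≤-antisym (γ-least _ γ′-ok) (γ′-least _ γ-ok)

IsConductor-≈ : X ≈ Y → IsConductor X γ → IsConductor Y γ
IsConductor-≈ X≈Y (γ-ok , γ-least) =
  (λ n γ≤n → trans (sym (X≈Y n)) (γ-ok n γ≤n)) ,
  (λ γ′ γ′-ok → γ-least γ′ (λ n γ′≤n → trans (X≈Y n) (γ′-ok n γ′≤n)))

mem-from : ∀ {F} → mem X F ≡ true → (∀ n → suc F ≤ n → mem X n ≡ true) → ∀ n → F ≤ n → mem X n ≡ true
mem-from F∈X above n F≤n with m≤n⇒m<n∨m≡n F≤n
... | inj₁ F<n  = above n F<n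
... | inj₂ refl = F∈X

IsFrobenius-∉ : ∀ {F} → IsFrobenius X F → mem X F ≡ false
IsFrobenius-∉ {X} {F} (above , least) with mem X F in F∈X
... | false = refl
... | true  = ⊥-elim (1+n≰n (least F (mem-from {X} F∈X above)))

module _ (af : AddFrob C P) where
  private
    F = proj₁ af

  AddFrob-∉ : mem C F ≡ false
  AddFrob-∉ = IsFrobenius-∉ {C} (proj₁ (proj₂ af))

  AddFrob-≢ : ∀ {n} → n ≢ F → mem C n ≡ mem P n
  AddFrob-≢ {n} n≢F = sym (trans (proj₂ (proj₂ af) n)
                                 (trans (cong (mem C n ∨_) (dec-false (n ≟ F) n≢F)) (∨-identityʳ (mem C n))))

  AddFrob-≥ : ∀ n → F ≤ n → mem P n ≡ true
  AddFrob-≥ n F≤n with m≤n⇒m<n∨m≡n F≤n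
  ... | inj₁ F<n  = trans (proj₂ (proj₂ af) n) (∨-trueˡ (proj₁ (proj₁ (proj₂ af)) n F<n))
  ... | inj₂ refl = trans (proj₂ (proj₂ af) n) (∨-trueʳ {a = mem C n} (dec-true (n ≟ n) refl))

  AddFrob-conductor≤ : IsConductor P γ → γ ≤ F
  AddFrob-conductor≤ (_ , least) = least F AddFrob-≥

AddFrob-parent-≈ : C ≈ C′ → (af : AddFrob C P) (af′ : AddFrob C′ P′) → proj₁ af ≡ proj₁ af′ × P ≈ P′
AddFrob-parent-≈ {C} {C′} C≈C′ (F , isF , P≡) (F′ , isF′ , P′≡) =
  F≡F′ , λ n → trans (P≡ n) (trans (cong₂ _∨_ (C≈C′ n) (cong (n ≡ᵇ_) F≡F′)) (sym (P′≡ n)))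
  where
  F≡F′ : F ≡ F′
  F≡F′ = suc-injective (IsConductor-unique {C′} (IsConductor-≈ {C} {C′} C≈C′ isF) isF′)

AddFrob-child-≈ : P ≈ P′ → (af : AddFrob C P) (af′ : AddFrob C′ P′) → proj₁ af ≡ proj₁ af′ → C ≈ C′
AddFrob-child-≈ {P} {P′} {C} {C′} P≈P′ af af′ F≡F′ n with n ≟ proj₁ af
... | yes refl = trans (AddFrob-∉ {C} {P} af) (sym (subst (λ m → mem C′ m ≡ false) (sym F≡F′) (AddFrob-∉ {C′} {P′} af′)))
... | no n≢F   = trans (AddFrob-≢ {C} {P} af n≢F)
                       (trans (P≈P′ n) (sym (AddFrob-≢ {C′} {P′} af′ (λ n≡F′ → n≢F (trans n≡F′ (sym F≡F′))))))

-- Infinite chains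

chainRoot : (ch : InfiniteChain) → IsN₀ (chainAt ch 0)
chainRoot (_ , root , _) = root

chainStep : (ch : InfiniteChain) → ∀ i → AddFrob (chainAt ch (suc i)) (chainAt ch i)
chainStep (_ , _ , step) = step

frobeniusAt : InfiniteChain → ℕ → ℕ
frobeniusAt ch i = proj₁ (chainStep ch i)

conductorAt : InfiniteChain → ℕ → ℕ
conductorAt ch zero    = 0
conductorAt ch (suc i) = suc (frobeniusAt ch i)

conductorAt-correct : ∀ ch i → IsConductor (chainAt ch i) (conductorAt ch i)
conductorAt-correct ch zero    = (λ n _ → chainRoot ch n) , (λ _ _ → z≤n)
conductorAt-correct ch (suc i) = proj₁ (proj₂ (chainStep ch i))

conductorAt≤frobeniusAt : ∀ ch i → conductorAt ch i ≤ frobeniusAt ch i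
conductorAt≤frobeniusAt ch i =
  AddFrob-conductor≤ {chainAt ch (suc i)} {chainAt ch i} (chainStep ch i) (conductorAt-correct ch i)

frobeniusAt-∉ : ∀ ch i → mem (chainAt ch (suc i)) (frobeniusAt ch i) ≡ false
frobeniusAt-∉ ch i = AddFrob-∉ {chainAt ch (suc i)} {chainAt ch i} (chainStep ch i)

chainStep-≢ : ∀ ch i {n} → n ≢ frobeniusAt ch i → mem (chainAt ch (suc i)) n ≡ mem (chainAt ch i) n
chainStep-≢ ch i = AddFrob-≢ {chainAt ch (suc i)} {chainAt ch i} (chainStep ch i)

conductorAt-≈ : ∀ ch ch′ {j j′} → chainAt ch j ≈ chainAt ch′ j′ → conductorAt ch j ≡ conductorAt ch′ j′
conductorAt-≈ ch ch′ {j} {j′} C≈C′ = IsConductor-unique {chainAt ch′ j′}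
  (IsConductor-≈ {chainAt ch j} {chainAt ch′ j′} C≈C′ (conductorAt-correct ch j)) (conductorAt-correct ch′ j′)

chain-index-unique : ∀ ch ch′ i i′ → chainAt ch i ≈ chainAt ch′ i′ → i ≡ i′
chain-index-unique ch ch′ zero    zero     _ = refl
chain-index-unique ch ch′ (suc i) (suc i′) Cᵢ≈C′ᵢ′ =
  cong suc (chain-index-unique ch ch′ i i′ (proj₂ (AddFrob-parent-≈
    {chainAt ch (suc i)} {chainAt ch′ (suc i′)} {chainAt ch i} {chainAt ch′ i′} Cᵢ≈C′ᵢ′ (chainStep ch i) (chainStep ch′ i′))))
chain-index-unique ch ch′ zero (suc i′) C₀≈C′ =
  ⊥-elim (true≢false (trans (sym (chainRoot ch _)) (trans (C₀≈C′ _) (frobeniusAt-∉ ch′ i′))))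
chain-index-unique ch ch′ (suc i) zero C≈C′₀ =
  ⊥-elim (true≢false (trans (sym (chainRoot ch′ _)) (trans (sym (C≈C′₀ _)) (frobeniusAt-∉ ch i))))

chains-agree-downward : ∀ ch ch′ {i} → chainAt ch i ≈ chainAt ch′ i → ∀ {j} → j ≤ i → chainAt ch j ≈ chainAt ch′ j
chains-agree-downward ch ch′ {zero}  C≈C′ z≤n = C≈C′
chains-agree-downward ch ch′ {suc i} C≈C′ {j} j≤i with m≤n⇒m<n∨m≡n j≤i
... | inj₂ refl = C≈C′
... | inj₁ j<i  = chains-agree-downward ch ch′ parents≈ (≤-pred j<i)
  where
  parents≈ = proj₂ (AddFrob-parent-≈ {chainAt ch (suc i)} {chainAt ch′ (suc i)} {chainAt ch i} {chainAt ch′ i}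
                      C≈C′ (chainStep ch i) (chainStep ch′ i))

chains-agree-upward : ∀ ch ch′ {i} → chainAt ch i ≈ chainAt ch′ i →
  (∀ k → chainAt ch (k + i) ≈ chainAt ch′ (k + i) → frobeniusAt ch (k + i) ≡ frobeniusAt ch′ (k + i)) →
  ∀ k → chainAt ch (k + i) ≈ chainAt ch′ (k + i)
chains-agree-upward ch ch′ C≈C′ same-F zero = C≈C′
chains-agree-upward ch ch′ {i} C≈C′ same-F (suc k) =
  AddFrob-child-≈ {chainAt ch (k + i)} {chainAt ch′ (k + i)} {chainAt ch (suc k + i)} {chainAt ch′ (suc k + i)}
    members≈ (chainStep ch (k + i)) (chainStep ch′ (k + i)) (same-F k members≈)
  where
  members≈ = chains-agree-upward ch ch′ C≈C′ same-F k

chains-agree : ∀ ch ch′ {i} → chainAt ch i ≈ chainAt ch′ i →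
  (∀ k → chainAt ch (k + i) ≈ chainAt ch′ (k + i) → frobeniusAt ch (k + i) ≡ frobeniusAt ch′ (k + i)) →
  SameChain ch ch′
chains-agree ch ch′ {i} C≈C′ same-F j with j ≤? i
... | yes j≤i = chains-agree-downward ch ch′ C≈C′ j≤i
... | no j≰i  = subst (λ m → chainAt ch m ≈ chainAt ch′ m) (m∸n+n≡m (<⇒≤ (≰⇒> j≰i)))
                      (chains-agree-upward ch ch′ C≈C′ same-F (j ∸ i))

module _ (ch : InfiniteChain) {i : ℕ} (X : NumericalSemigroup) {γ : ℕ}
         (Cᵢ≈X : chainAt ch i ≈ X) (X-cond : IsConductor X γ) where

  chain-conductor-≥ : ∀ k → γ + k ≤ conductorAt ch (k + i)
  chain-conductor-≥ zero = ≤-reflexive (trans (+-identityʳ γ)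
    (IsConductor-unique {X} X-cond (IsConductor-≈ {chainAt ch i} {X} Cᵢ≈X (conductorAt-correct ch i))))
  chain-conductor-≥ (suc k) = subst (_≤ suc (frobeniusAt ch (k + i))) (sym (+-suc γ k))
    (s≤s (≤-trans (chain-conductor-≥ k) (conductorAt≤frobeniusAt ch (k + i))))

  chain-agrees : ∀ k {n} → n < γ → mem (chainAt ch (k + i)) n ≡ mem X n
  chain-agrees zero    n<γ = Cᵢ≈X _
  chain-agrees (suc k) {n} n<γ =
    trans (chainStep-≢ ch (k + i) n≢F) (chain-agrees k n<γ)
    where
    n≢F : n ≢ frobeniusAt ch (k + i)
    n≢F refl = 1+n≰n (≤-trans n<γ (≤-trans (m≤m+n γ k)
                 (≤-trans (chain-conductor-≥ k) (conductorAt≤frobeniusAt ch (k + i)))))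

  chain-⊇-elemsBelow : ∀ k {x} → x ∈ elemsBelow X γ → mem (chainAt ch (k + i)) x ≡ true
  chain-⊇-elemsBelow k x∈E with ∈-elemsBelow⁻ {X} x∈E
  ... | x∈X , x<γ = trans (chain-agrees k x<γ) x∈X

LiesInSomeChain⇒gcd≢1 : IsConductor X γ → LiesInSomeChain X → gcdList (elemsBelow X γ) ≢ 1
LiesInSomeChain⇒gcd≢1 {X} {γ} X-cond (ch , i , Cᵢ≈X) gcd≡1 with Generated-coprime-cofinite (elemsBelow X γ) gcd≡1
... | R , cofinite = 1+n≰n (≤-trans (m≤n+m (suc R) γ) (≤-trans (chain-conductor-≥ ch X Cᵢ≈X X-cond (suc R)) conductor≤R))
  where
  conductor≤R : conductorAt ch (suc R + i) ≤ R
  conductor≤R = proj₂ (conductorAt-correct ch (suc R + i)) R λ n R≤n →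
    Generated-⊆ (chainAt ch (suc R + i)) (chain-⊇-elemsBelow ch X Cᵢ≈X X-cond (suc R)) (cofinite n R≤n)

-- Chains built from a sparse submonoid

≤ᵇ-split : ∀ t n → (t ≤ᵇ n) ≡ (suc t ≤ᵇ n) ∨ (n ≡ᵇ t)
≤ᵇ-split t n with <-cmp n t
... | tri< n<t _ _  = trans (dec-false (t ≤? n) (<⇒≱ n<t))
    (sym (cong₂ _∨_ (dec-false (suc t ≤? n) (<⇒≱ (m<n⇒m<1+n n<t))) (dec-false (n ≟ t) (<⇒≢ n<t))))
... | tri≈ _ refl _ = trans (dec-true (n ≤? n) ≤-refl)
    (sym (cong₂ _∨_ (dec-false (suc n ≤? n) 1+n≰n) (dec-true (n ≟ n) refl)))
... | tri> _ _ t<n  = trans (dec-true (t ≤? n) (<⇒≤ t<n)) (sym (∨-trueˡ (dec-true (suc t ≤? n) t<n)))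

module TailChain (M : ℕ → Bool) (M-zero : M 0 ≡ true)
                 (M-add : ∀ a b → M a ≡ true → M b ≡ true → M (a + b) ≡ true)
                 (M-sparse : ∀ t → M t ≡ true → M (suc t) ≡ false) where

  infix 25 M∪≥_

  M∪≥_ : ℕ → NumericalSemigroup
  M∪≥ t = record
    { mem      = λ n → M n ∨ (t ≤ᵇ n)
    ; mem-zero = ∨-trueˡ M-zero
    ; mem-add  = add
    ; bound    = t
    ; bound-ok = λ n t≤n → ∨-trueʳ {a = M n} (dec-true (t ≤? n) t≤n)
    }
    where
    add : ∀ a b → M a ∨ (t ≤ᵇ a) ≡ true → M b ∨ (t ≤ᵇ b) ≡ true → M (a + b) ∨ (t ≤ᵇ a + b) ≡ true
    add a b a∈ b∈ with ∨-true⁻ {M a} a∈ | ∨-true⁻ {M b} b∈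
    ... | inj₁ Ma | inj₁ Mb = ∨-trueˡ (M-add a b Ma Mb)
    ... | inj₂ t≤a | _ = ∨-trueʳ {a = M (a + b)} (dec-true (t ≤? a + b) (≤-trans (does⇒ (t ≤? a) t≤a) (m≤m+n a b)))
    ... | inj₁ _ | inj₂ t≤b = ∨-trueʳ {a = M (a + b)} (dec-true (t ≤? a + b) (≤-trans (does⇒ (t ≤? b) t≤b) (m≤n+m b a)))

  M∪-split : ∀ t n → mem (M∪≥ t) n ≡ mem (M∪≥ suc t) n ∨ (n ≡ᵇ t)
  M∪-split t n = trans (cong (M n ∨_) (≤ᵇ-split t n)) (sym (∨-assoc (M n) (suc t ≤ᵇ n) (n ≡ᵇ t)))

  M∪-shift : ∀ t → M t ≡ true → M∪≥ t ≈ M∪≥ suc t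
  M∪-shift t Mt n with n ≟ t
  ... | yes refl = trans (∨-trueˡ Mt) (sym (∨-trueˡ Mt))
  ... | no n≢t   = trans (M∪-split t n) (trans (cong (mem (M∪≥ suc t) n ∨_) (dec-false (n ≟ t) n≢t)) (∨-identityʳ _))

  -- The least non-element of M from t on; it is t or t + 1 since M is sparse.
  skip : ℕ → ℕ
  skip t with M t
  ... | true  = suc t
  ... | false = t

  skip-cases : ∀ t → (M t ≡ true × skip t ≡ suc t) ⊎ (M t ≡ false × skip t ≡ t)
  skip-cases t with M t
  ... | true  = inj₁ (refl , refl)
  ... | false = inj₂ (refl , refl)

  skip-∉ : ∀ t → M (skip t) ≡ false
  skip-∉ t with skip-cases t
  ... | inj₁ (Mt , eq) = subst (λ u → M u ≡ false) (sym eq) (M-sparse t Mt)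
  ... | inj₂ (Mt , eq) = subst (λ u → M u ≡ false) (sym eq) Mt

  ≤-skip : ∀ t → t ≤ skip t
  ≤-skip t with skip-cases t
  ... | inj₁ (_ , eq) = ≤-trans (n≤1+n t) (≤-reflexive (sym eq))
  ... | inj₂ (_ , eq) = ≤-reflexive (sym eq)

  M∪-skip : ∀ t → M∪≥ t ≈ M∪≥ skip t
  M∪-skip t with skip-cases t
  ... | inj₁ (Mt , eq) = subst (λ u → M∪≥ t ≈ M∪≥ u) (sym eq) (M∪-shift t Mt)
  ... | inj₂ (_ , eq)  = subst (λ u → M∪≥ t ≈ M∪≥ u) (sym eq) (λ _ → refl)

  M∪-frobenius : ∀ t → M t ≡ false → IsFrobenius (M∪≥ suc t) t
  M∪-frobenius t Mt = bound-ok (M∪≥ suc t) , least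
    where
    least : ∀ γ → (∀ n → γ ≤ n → mem (M∪≥ suc t) n ≡ true) → suc t ≤ γ
    least γ above with suc t ≤? γ
    ... | yes t<γ = t<γ
    ... | no t≮γ = ⊥-elim (true≢false (trans (sym (above t (≤-pred (≰⇒> t≮γ))))
                                              (cong₂ _∨_ Mt (dec-false (suc t ≤? t) 1+n≰n))))

  start : ℕ → ℕ
  start zero    = 0
  start (suc i) = suc (skip (start i))

  chain : InfiniteChain
  chain = M∪≥_ ∘ start , (λ n → ∨-trueʳ {a = M n} refl) , step
    where
    step : ∀ i → AddFrob (M∪≥ start (suc i)) (M∪≥ start i)
    step i = skip (start i) , M∪-frobenius (skip (start i)) (skip-∉ (start i)) ,
             λ n → trans (M∪-skip (start i) n) (M∪-split (skip (start i)) n)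

  start-reaches : ∀ t → ∃ λ i → t ≡ start i ⊎ t ≡ skip (start i)
  start-reaches zero = 0 , inj₁ refl
  start-reaches (suc t) with start-reaches t
  ... | i , inj₂ refl = suc i , inj₁ refl
  ... | i , inj₁ refl with skip-cases (start i)
  ...   | inj₁ (_ , eq) = i , inj₂ (sym eq)
  ...   | inj₂ (_ , eq) = suc i , inj₁ (cong suc (sym eq))

  chain-through : ∀ t → ∃ λ i → chainAt chain i ≈ M∪≥ t
  chain-through t with start-reaches t
  ... | i , inj₁ refl = i , λ _ → refl
  ... | i , inj₂ refl = i , M∪-skip (start i)

  ≤-start : ∀ i → i ≤ start i
  ≤-start zero    = z≤n
  ≤-start (suc i) = s≤s (≤-trans (≤-start i) (≤-skip (start i)))

  chain-below : ∀ n → mem (chainAt chain (suc n)) n ≡ M n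
  chain-below n = trans (cong (M n ∨_) (dec-false (start (suc n) ≤? n) (<⇒≱ (≤-start (suc n))))) (∨-identityʳ (M n))

module ChainWithin (Λ : NumericalSemigroup) {c : ℕ} (Λ-cond : IsConductor Λ c)
  (Q : ℕ → Bool) (Q-zero : Q 0 ≡ true)
  (Q-add : ∀ a b → Q a ≡ true → Q b ≡ true → Q (a + b) ≡ true)
  (Q-sparse : ∀ t → Q t ≡ true → Q (suc t) ≡ false)
  (Q-below : ∀ {n} → mem Λ n ≡ true → n < c → Q n ≡ true) where

  private
    M : ℕ → Bool
    M n = mem Λ n ∧ Q n

    M-add : ∀ a b → M a ≡ true → M b ≡ true → M (a + b) ≡ true
    M-add a b Ma Mb with ∧-true⁻ {mem Λ a} Ma | ∧-true⁻ {mem Λ b} Mb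
    ... | a∈Λ , Qa | b∈Λ , Qb = ∧-true (mem-add Λ a b a∈Λ b∈Λ) (Q-add a b Qa Qb)

    M-sparse : ∀ t → M t ≡ true → M (suc t) ≡ false
    M-sparse t Mt = trans (cong (mem Λ (suc t) ∧_) (Q-sparse t (proj₂ (∧-true⁻ {mem Λ t} Mt)))) (∧-zeroʳ _)

  open TailChain M (∧-true (mem-zero Λ) Q-zero) M-add M-sparse public using (chain; chain-below)
  open TailChain M (∧-true (mem-zero Λ) Q-zero) M-add M-sparse using (M∪≥_; chain-through)

  private
    M∪≥c≈Λ : M∪≥ c ≈ Λ
    M∪≥c≈Λ n with c ≤? n
    ... | yes c≤n = trans (∨-trueʳ {a = M n} (dec-true (c ≤? n) c≤n)) (sym (proj₁ Λ-cond n c≤n))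
    ... | no c≰n with mem Λ n in n∈Λ
    ...   | true  = ∨-trueˡ (Q-below n∈Λ (≰⇒> c≰n))
    ...   | false = dec-false (c ≤? n) c≰n

  chain-lies : LiesIn Λ chain
  chain-lies with chain-through c
  ... | i , Cᵢ≈M∪≥c = i , ≈-trans {chainAt chain i} {M∪≥ c} {Λ} Cᵢ≈M∪≥c M∪≥c≈Λ

-- Descendants

insert : (D : NumericalSemigroup) (u : ℕ) → (∀ n → suc u ≤ n → mem D n ≡ true) → NumericalSemigroup
insert D u above = record
  { mem      = λ n → mem D n ∨ (n ≡ᵇ u)
  ; mem-zero = ∨-trueˡ (mem-zero D)
  ; mem-add  = add
  ; bound    = u
  ; bound-ok = from-u
  }
  where
  from-u : ∀ n → u ≤ n → mem D n ∨ (n ≡ᵇ u) ≡ true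
  from-u n u≤n with m≤n⇒m<n∨m≡n u≤n
  ... | inj₁ u<n  = ∨-trueˡ (above n u<n)
  ... | inj₂ refl = ∨-trueʳ {a = mem D n} (dec-true (n ≟ n) refl)
  below-u : ∀ n → n < u → mem D n ∨ (n ≡ᵇ u) ≡ true → mem D n ≡ true
  below-u n n<u n∈ = trans (sym (∨-identityʳ (mem D n))) (trans (cong (mem D n ∨_) (sym (dec-false (n ≟ u) (<⇒≢ n<u)))) n∈)
  add : ∀ a b → mem D a ∨ (a ≡ᵇ u) ≡ true → mem D b ∨ (b ≡ᵇ u) ≡ true → mem D (a + b) ∨ (a + b ≡ᵇ u) ≡ true
  add a b a∈ b∈ with u ≤? a + b
  ... | yes u≤a+b = from-u (a + b) u≤a+b
  ... | no u≰a+b  = ∨-trueˡ (mem-add D a b (below-u a (≤-<-trans (m≤m+n a b) (≰⇒> u≰a+b)) a∈)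
                                           (below-u b (≤-<-trans (m≤n+m b a) (≰⇒> u≰a+b)) b∈))

AgreesBelow : NumericalSemigroup → NumericalSemigroup → ℕ → Set
AgreesBelow D Λ c = ∀ n → n < c → mem D n ≡ mem Λ n

module _ (Λ : NumericalSemigroup) {c : ℕ} (Λ-cond : IsConductor Λ c) where

  -- Insert the gaps of D that lie above c one at a time, from the largest down.
  AgreesBelow⇒Descendant : ∀ D → AgreesBelow D Λ c → Descendant Λ D
  AgreesBelow⇒Descendant D D≈Λ = go (bound D) D (λ n b≤n → bound-ok D n (≤-trans (m≤n+m (bound D) c) b≤n)) D≈Λ
    where
    go : ∀ k D → (∀ n → c + k ≤ n → mem D n ≡ true) → AgreesBelow D Λ c → Descendant Λ D
    go zero D above D≈Λ = desc-self λ n → case-c n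
      where
      case-c : ∀ n → mem D n ≡ mem Λ n
      case-c n with n <? c
      ... | yes n<c = D≈Λ n n<c
      ... | no n≮c  = trans (above n (≤-trans (≤-reflexive (+-identityʳ c)) (≮⇒≥ n≮c)))
                            (sym (proj₁ Λ-cond n (≮⇒≥ n≮c)))
    go (suc k) D above D≈Λ with mem D (c + k) in u∈D
    ... | true  = go k D (mem-from {D} u∈D (λ n → above n ∘ ≤-trans (≤-reflexive (+-suc c k)))) D≈Λ
    ... | false = desc-child (go k D∪u (bound-ok D∪u) D∪u≈Λ) (c + k , (above′ , least) , λ _ → refl)
      where
      above′ : ∀ n → suc (c + k) ≤ n → mem D n ≡ true
      above′ n = above n ∘ ≤-trans (≤-reflexive (+-suc c k))
      D∪u = insert D (c + k) above′
      D∪u≈Λ : AgreesBelow D∪u Λ c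
      D∪u≈Λ n n<c = trans (cong (mem D n ∨_) (dec-false (n ≟ c + k) (<⇒≢ (<-≤-trans n<c (m≤m+n c k)))))
                        (trans (∨-identityʳ (mem D n)) (D≈Λ n n<c))
      least : ∀ γ → (∀ n → γ ≤ n → mem D n ≡ true) → suc (c + k) ≤ γ
      least γ from-γ with suc (c + k) ≤? γ
      ... | yes u<γ = u<γ
      ... | no u≮γ  = ⊥-elim (true≢false (trans (sym (from-γ (c + k) (≤-pred (≰⇒> u≮γ)))) u∈D))

  -- The Frobenius number removed at each step is at least c, since its parent agrees with Λ below c.
  Descendant⇒AgreesBelow : ∀ {D} → Descendant Λ D → AgreesBelow D Λ c
  Descendant⇒AgreesBelow (desc-self D≈Λ) n _ = D≈Λ n
  Descendant⇒AgreesBelow (desc-child {P} {D} desc af) n n<c =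
    trans (AddFrob-≢ {D} {P} af n≢F) (P≈Λ n n<c)
    where
    P≈Λ = Descendant⇒AgreesBelow desc
    F = proj₁ af
    Λ-from-F : ∀ n → F ≤ n → mem Λ n ≡ true
    Λ-from-F n F≤n with n <? c
    ... | yes n<c = trans (sym (P≈Λ n n<c)) (AddFrob-≥ {D} {P} af n F≤n)
    ... | no n≮c  = proj₁ Λ-cond n (≮⇒≥ n≮c)
    n≢F : n ≢ F
    n≢F refl = 1+n≰n (≤-trans n<c (proj₂ Λ-cond F Λ-from-F))

generatedSemigroup : (L : List ℕ) (R : ℕ) → (∀ n → R ≤ n → Generated L n) → NumericalSemigroup
generatedSemigroup L R cofinite = record
  { mem      = generatedᵇ L
  ; mem-zero = refl
  ; mem-add  = λ a b a∈ b∈ → Equivalence.from (generatedᵇ-true⇔ (a + b))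
                 (Generated-+ (Equivalence.to (generatedᵇ-true⇔ a) a∈) (Equivalence.to (generatedᵇ-true⇔ b) b∈))
  ; bound    = R
  ; bound-ok = λ n R≤n → Equivalence.from (generatedᵇ-true⇔ n) (cofinite n R≤n)
  }

module MaximalDescendant (Λ : NumericalSemigroup) {c : ℕ} (Λ-cond : IsConductor Λ c)
                         (gcd≡1 : gcdList (elemsBelow Λ c) ≡ 1) where

  private
    E = elemsBelow Λ c

  S : NumericalSemigroup
  S = generatedSemigroup E _ (proj₂ (Generated-coprime-cofinite E gcd≡1))

  S-mem⇔ : ∀ n → (mem S n ≡ true) ⇔ Generated E n
  S-mem⇔ = generatedᵇ-true⇔

  S-agrees : AgreesBelow S Λ c
  S-agrees n n<c with mem Λ n in n∈Λ
  ... | true  = Equivalence.from (S-mem⇔ n) (Generated-∈ (∈-elemsBelow⁺ {Λ} n∈Λ n<c))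
  ... | false with mem S n in n∈S
  ...   | false = refl
  ...   | true  = ⊥-elim (true≢false (trans (sym n∈Λ′) n∈Λ))
    where n∈Λ′ = Generated-⊆ Λ (proj₁ ∘ ∈-elemsBelow⁻ {Λ} {c = c}) (Equivalence.to (S-mem⇔ n) n∈S)

  S-descendant : Descendant Λ S
  S-descendant = AgreesBelow⇒Descendant Λ Λ-cond S S-agrees

  S-maximal : ∀ D → Descendant Λ D → genus D ≤ genus S × (genus D ≡ genus S → D ≈ S)
  S-maximal D desc = genus-antitone {S} {D} λ {n} n∈S →
    Generated-⊆ D (λ x∈E → let x∈Λ , x<c = ∈-elemsBelow⁻ {Λ} x∈E
                           in trans (Descendant⇒AgreesBelow Λ Λ-cond desc _ x<c) x∈Λ)
                  (Equivalence.to (S-mem⇔ n) n∈S)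

infix 5 _∣ᵇ_

_∣ᵇ_ : ℕ → ℕ → Bool
k ∣ᵇ n = does (k ∣? n)

∣⇒∤suc : ∀ {a t} → 2 ≤ a → a ∣ t → ¬ a ∣ suc t
∣⇒∤suc {a} {t} 2≤a a∣t a∣1+t = <⇒≢ 2≤a (sym (∣1⇒≡1 (∣m+n∣m⇒∣n (subst (a ∣_) (+-comm 1 t) a∣1+t) a∣t)))

nontrivial-divisor : ∀ d → d ≢ 1 → ∃ λ e → 2 ≤ e × e ∣ d
nontrivial-divisor zero          _   = 2 , ≤-refl , (2 ∣0)
nontrivial-divisor (suc zero)    d≢1 = ⊥-elim (d≢1 refl)
nontrivial-divisor (suc (suc k)) _   = suc (suc k) , s≤s (s≤s z≤n) , ∣-refl

gcd≢1⇒LiesInSomeChain : ∀ {Λ c} → IsConductor Λ c → gcdList (elemsBelow Λ c) ≢ 1 → LiesInSomeChain Λ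
gcd≢1⇒LiesInSomeChain {Λ} {c} Λ-cond gcd≢1 with nontrivial-divisor _ gcd≢1
... | e , 2≤e , e∣d = chain , chain-lies
  where
  multiple-add : ∀ a b → e ∣ᵇ a ≡ true → e ∣ᵇ b ≡ true → e ∣ᵇ (a + b) ≡ true
  multiple-add a b e∣a e∣b = dec-true (e ∣? a + b) (∣m∣n⇒∣m+n (does⇒ (e ∣? a) e∣a) (does⇒ (e ∣? b) e∣b))
  multiple-sparse : ∀ t → e ∣ᵇ t ≡ true → e ∣ᵇ suc t ≡ false
  multiple-sparse t e∣t = dec-false (e ∣? suc t) (∣⇒∤suc 2≤e (does⇒ (e ∣? t) e∣t))
  multiple-below : ∀ {n} → mem Λ n ≡ true → n < c → e ∣ᵇ n ≡ true
  multiple-below n∈Λ n<c = dec-true (e ∣? _) (∣-trans e∣d (gcdList-∣ (∈-elemsBelow⁺ {Λ} n∈Λ n<c)))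
  open ChainWithin Λ Λ-cond (e ∣ᵇ_) (dec-true (e ∣? 0) (e ∣0)) multiple-add multiple-sparse multiple-below

composite-factorization : ∀ d → d ≢ 1 → ¬ Prime d → ∃ λ a → ∃ λ b → 2 ≤ a × 2 ≤ b × a * b ∣ d
composite-factorization zero          _   _ = 2 , 2 , ≤-refl , ≤-refl , (4 ∣0)
composite-factorization (suc zero)    d≢1 _ = ⊥-elim (d≢1 refl)
composite-factorization d@(suc (suc _)) _ ¬prime with ¬prime⇒composite ¬prime
... | hasNonTrivialDivisor {q} q<d (divides r d≡rq) =
  q , r , nonTrivial⇒n>1 q , cofactor≥2 r d≡rq , ∣-reflexive (trans (*-comm q r) (sym d≡rq))
  where
  cofactor≥2 : ∀ r → d ≡ r * q → 2 ≤ r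
  cofactor≥2 zero          ()
  cofactor≥2 (suc zero)    d≡q = ⊥-elim (<-irrefl (sym (trans d≡q (+-identityʳ q))) q<d)
  cofactor≥2 (suc (suc _)) _   = s≤s (s≤s z≤n)

-- With d divisible by a b, the chains built from a b ℕ ∪ (a ℕ ∩ [T, ∞)) for different
-- thresholds T = a (b (c + k) + 1) first differ at T itself.
module ManyChains (Λ : NumericalSemigroup) {c : ℕ} (Λ-cond : IsConductor Λ c) {a b : ℕ}
                  (2≤a : 2 ≤ a) (2≤b : 2 ≤ b) (ab∣d : a * b ∣ gcdList (elemsBelow Λ c)) where

  private instance
    a≢0 = >-nonZero (≤-trans (s≤s z≤n) 2≤a)
    b≢0 = >-nonZero (≤-trans (s≤s z≤n) 2≤b)

  cover : ℕ → ℕ → Bool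
  cover T n = (a * b ∣ᵇ n) ∨ ((a ∣ᵇ n) ∧ (T ≤ᵇ n))

  module _ (T : ℕ) where

    private
      cover-cases : ∀ x → cover T x ≡ true → a * b ∣ x ⊎ (a ∣ x × T ≤ x)
      cover-cases x x∈ with ∨-true⁻ {a * b ∣ᵇ x} x∈
      ... | inj₁ ab∣x = inj₁ (does⇒ (a * b ∣? x) ab∣x)
      ... | inj₂ rest with ∧-true⁻ {a ∣ᵇ x} rest
      ...   | a∣x , T≤x = inj₂ (does⇒ (a ∣? x) a∣x , does⇒ (T ≤? x) T≤x)

      cover-∣ : ∀ x → cover T x ≡ true → a ∣ x
      cover-∣ x x∈ with cover-cases x x∈
      ... | inj₁ ab∣x       = ∣-trans (m∣m*n b) ab∣x
      ... | inj₂ (a∣x , _) = a∣x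

      cover-add : ∀ x y → cover T x ≡ true → cover T y ≡ true → cover T (x + y) ≡ true
      cover-add x y x∈ y∈ with T ≤? x + y
      ... | yes T≤x+y = ∨-trueʳ {a = a * b ∣ᵇ (x + y)}
            (∧-true (dec-true (a ∣? x + y) (∣m∣n⇒∣m+n (cover-∣ x x∈) (cover-∣ y y∈))) (dec-true (T ≤? x + y) T≤x+y))
      ... | no T≰x+y with cover-cases x x∈ | cover-cases y y∈
      ...   | inj₂ (_ , T≤x) | _              = ⊥-elim (T≰x+y (≤-trans T≤x (m≤m+n x y)))
      ...   | inj₁ _         | inj₂ (_ , T≤y) = ⊥-elim (T≰x+y (≤-trans T≤y (m≤n+m y x)))
      ...   | inj₁ ab∣x      | inj₁ ab∣y      = ∨-trueˡ (dec-true (a * b ∣? x + y) (∣m∣n⇒∣m+n ab∣x ab∣y))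

      cover-sparse : ∀ t → cover T t ≡ true → cover T (suc t) ≡ false
      cover-sparse t t∈ with cover T (suc t) in t+1∈
      ... | false = refl
      ... | true  = ⊥-elim (∣⇒∤suc 2≤a (cover-∣ t t∈) (cover-∣ (suc t) t+1∈))

      cover-below : ∀ {n} → mem Λ n ≡ true → n < c → cover T n ≡ true
      cover-below n∈Λ n<c = ∨-trueˡ (dec-true (a * b ∣? _) (∣-trans ab∣d (gcdList-∣ (∈-elemsBelow⁺ {Λ} n∈Λ n<c))))

    open ChainWithin Λ Λ-cond (cover T) (∨-trueˡ (dec-true (a * b ∣? 0) (_ ∣0))) cover-add cover-sparse cover-below public

  threshold : ℕ → ℕ
  threshold k = a * (b * (c + k) + 1)

  threshold-mono : ∀ {j k} → j < k → threshold j < threshold k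
  threshold-mono j<k = *-monoʳ-< a (+-monoˡ-< 1 (*-monoʳ-< b (+-monoʳ-< c j<k)))

  c≤threshold : ∀ k → c ≤ threshold k
  c≤threshold k = ≤-trans (m≤m+n c k) (≤-trans (m≤n*m (c + k) b) (≤-trans (m≤m+n _ 1) (m≤n*m _ a)))

  threshold-∤ : ∀ k → ¬ a * b ∣ threshold k
  threshold-∤ k ab∣T = <⇒≢ 2≤b (sym (∣1⇒≡1 (∣m+n∣m⇒∣n (*-cancelˡ-∣ a ab∣T) (m∣m*n (c + k)))))

  family : ℕ → InfiniteChain
  family k = chain (threshold k)

  threshold-∈ : ∀ k → cover (threshold k) (threshold k) ≡ true
  threshold-∈ k = ∨-trueʳ {a = a * b ∣ᵇ threshold k}
    (∧-true (dec-true (a ∣? _) (m∣m*n (b * (c + k) + 1))) (dec-true (threshold k ≤? threshold k) ≤-refl))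

  threshold-∉ : ∀ {j k} → j < k → cover (threshold k) (threshold j) ≡ false
  threshold-∉ {j} {k} j<k = cong₂ _∨_ (dec-false (a * b ∣? _) (threshold-∤ j))
    (trans (cong ((a ∣ᵇ threshold j) ∧_) (dec-false (threshold k ≤? threshold j) (<⇒≱ (threshold-mono j<k)))) (∧-zeroʳ _))

  family-∋ : ∀ k → mem (chainAt (family k) (suc (threshold k))) (threshold k) ≡ true
  family-∋ k = trans (chain-below (threshold k) (threshold k)) (∧-true (proj₁ Λ-cond _ (c≤threshold k)) (threshold-∈ k))

  family-∌ : ∀ {j k} → j < k → mem (chainAt (family k) (suc (threshold j))) (threshold j) ≡ false
  family-∌ {j} {k} j<k = trans (chain-below (threshold k) (threshold j))
    (trans (cong (mem Λ (threshold j) ∧_) (threshold-∉ j<k)) (∧-zeroʳ _))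

  family-distinct : ∀ j k → j ≢ k → ¬ SameChain (family j) (family k)
  family-distinct j k j≢k same with <-cmp j k
  ... | tri< j<k _ _ = true≢false (trans (sym (family-∋ j)) (trans (same _ _) (family-∌ j<k)))
  ... | tri≈ _ j≡k _ = j≢k j≡k
  ... | tri> _ _ k<j = true≢false (trans (sym (family-∋ k)) (trans (sym (same _ _)) (family-∌ k<j)))

  liesInInfinitelyManyChains : LiesInInfinitelyManyChains Λ
  liesInInfinitelyManyChains = family , (λ k → chain-lies (threshold k)) , family-distinct

-- The offsets frob k ∸ cond k are bits, forced from k = K on, so a chain through Λ is determined
-- by K bits and among 2 ^ K + 1 such chains two coincide.
module PrimeGcd (Λ : NumericalSemigroup) {c : ℕ} (Λ-cond : IsConductor Λ c)
                (p-prime : Prime (gcdList (elemsBelow Λ c))) where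

  private
    E = elemsBelow Λ c
    p = gcdList E
    R = proj₁ (Generated-cofinite E)
    K = p * R

  2≤p : 2 ≤ p
  2≤p = nonTrivial⇒n>1 p {{prime⇒nonTrivial p-prime}}

  module Through (ch : InfiniteChain) {i : ℕ} (Cᵢ≈Λ : chainAt ch i ≈ Λ) where

    private
      member : ℕ → NumericalSemigroup
      member k = chainAt ch (k + i)
      cond frob : ℕ → ℕ
      cond k = conductorAt ch (k + i)
      frob k = frobeniusAt ch (k + i)

    c≤cond : ∀ k → c ≤ cond k
    c≤cond k = ≤-trans (m≤m+n c k) (chain-conductor-≥ ch Λ Cᵢ≈Λ Λ-cond k)

    member-gcd≡p : ∀ k → gcdList (elemsBelow (member k) (cond k)) ≡ p
    member-gcd≡p k with prime⇒irreducible p-prime gcd∣p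
      where
      gcd∣p = gcdList-greatest E λ {x} x∈E →
        gcdList-∣ (∈-elemsBelow⁺ {member k} (chain-⊇-elemsBelow ch Λ Cᵢ≈Λ Λ-cond k x∈E)
                                 (<-≤-trans (proj₂ (∈-elemsBelow⁻ {Λ} x∈E)) (c≤cond k)))
    ... | inj₁ gcd≡1 = ⊥-elim (LiesInSomeChain⇒gcd≢1 {member k} (conductorAt-correct ch (k + i)) (ch , k + i , λ _ → refl) gcd≡1)
    ... | inj₂ gcd≡p = gcd≡p

    member-∣ : ∀ k {n} → mem (member k) n ≡ true → n < cond k → p ∣ n
    member-∣ k n∈ n<cond = subst (_∣ _) (member-gcd≡p k) (gcdList-∣ (∈-elemsBelow⁺ {member k} n∈ n<cond))

    cond≤frob : ∀ k → cond k ≤ frob k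
    cond≤frob k = conductorAt≤frobeniusAt ch (k + i)

    child-∋ : ∀ k {m} → cond k ≤ m → m ≢ frob k → mem (member (suc k)) m ≡ true
    child-∋ k cond≤m m≢frob = trans (chainStep-≢ ch (k + i) m≢frob) (proj₁ (conductorAt-correct ch (k + i)) _ cond≤m)

    frob≤1+cond : ∀ k → frob k ≤ suc (cond k)
    frob≤1+cond k with frob k ≤? suc (cond k)
    ... | yes frob≤1+cond = frob≤1+cond
    ... | no frob≰1+cond  = ⊥-elim (∣⇒∤suc 2≤p (p∣ ≤-refl (n≤1+n _)) (p∣ (n≤1+n _) ≤-refl))
      where
      p∣ : ∀ {m} → cond k ≤ m → m ≤ suc (cond k) → p ∣ m
      p∣ cond≤m m≤1+cond = member-∣ (suc k) (child-∋ k cond≤m (<⇒≢ m<frob)) (s≤s (<⇒≤ m<frob))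
        where m<frob = ≤-<-trans m≤1+cond (≰⇒> frob≰1+cond)

    frob-∤ : ∀ k → ¬ p ∣ cond k → frob k ≡ cond k
    frob-∤ k p∤cond with m≤n⇒m<n∨m≡n (cond≤frob k)
    ... | inj₂ cond≡frob = sym cond≡frob
    ... | inj₁ cond<frob = ⊥-elim (p∤cond (member-∣ (suc k) (child-∋ k ≤-refl (<⇒≢ cond<frob)) (s≤s (cond≤frob k))))

    frob-∣ : ∀ k → K ≤ cond k → p ∣ cond k → frob k ≡ suc (cond k)
    frob-∣ k K≤cond p∣cond with m≤n⇒m<n∨m≡n (cond≤frob k)
    ... | inj₁ cond<frob = ≤-antisym (frob≤1+cond k) cond<frob
    ... | inj₂ cond≡frob = ⊥-elim (true≢false (trans (sym cond∈child)
                             (subst (λ m → mem (member (suc k)) m ≡ false) (sym cond≡frob) (frobeniusAt-∉ ch (k + i)))))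
      where
      cond∈child = Generated-⊆ (member (suc k)) (chain-⊇-elemsBelow ch Λ Cᵢ≈Λ Λ-cond (suc k))
                  (proj₂ (Generated-cofinite E) (cond k) K≤cond p∣cond)

    offset : ℕ → ℕ
    offset k = frob k ∸ cond k

    offset<2 : ∀ k → offset k < 2
    offset<2 k = s≤s (≤-trans (∸-monoˡ-≤ (cond k) (frob≤1+cond k)) (≤-reflexive (m+n∸n≡m 1 (cond k))))

    bits : Fin K → Fin 2
    bits k = fromℕ< (offset<2 (toℕ k))

  same-offsets⇒SameChain : ∀ ch ch′ {i} (Cᵢ≈Λ : chainAt ch i ≈ Λ) (C′ᵢ≈Λ : chainAt ch′ i ≈ Λ) →
    (∀ (j : Fin K) → Through.offset ch Cᵢ≈Λ (toℕ j) ≡ Through.offset ch′ C′ᵢ≈Λ (toℕ j)) → SameChain ch ch′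
  same-offsets⇒SameChain ch ch′ {i} Cᵢ≈Λ C′ᵢ≈Λ same-offset =
    chains-agree ch ch′ (≈-trans {chainAt ch i} {Λ} {chainAt ch′ i} Cᵢ≈Λ (≈-sym {chainAt ch′ i} {Λ} C′ᵢ≈Λ))
      (λ k → same-frobenius k ∘ conductorAt-≈ ch ch′)
    where
    module T  = Through ch Cᵢ≈Λ
    module T′ = Through ch′ C′ᵢ≈Λ
    same-frobenius : ∀ k → conductorAt ch (k + i) ≡ conductorAt ch′ (k + i) → frobeniusAt ch (k + i) ≡ frobeniusAt ch′ (k + i)
    same-frobenius k same-cond with k <? K
    ... | yes k<K = begin
      frobeniusAt ch (k + i)                 ≡⟨ sym (m+[n∸m]≡n (T.cond≤frob k)) ⟩
      conductorAt ch (k + i) + T.offset k    ≡⟨ cong₂ _+_ same-cond (subst (λ m → T.offset m ≡ T′.offset m)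
                                                  (toℕ-fromℕ< k<K) (same-offset (fromℕ< k<K))) ⟩
      conductorAt ch′ (k + i) + T′.offset k  ≡⟨ m+[n∸m]≡n (T′.cond≤frob k) ⟩
      frobeniusAt ch′ (k + i)                ∎
      where open ≡-Reasoning
    ... | no k≮K with p ∣? conductorAt ch (k + i)
    ...   | yes p∣cond = trans (T.frob-∣ k K≤cond p∣cond) (trans (cong suc same-cond)
                           (sym (T′.frob-∣ k (subst (K ≤_) same-cond K≤cond) (subst (p ∣_) same-cond p∣cond))))
      where K≤cond = ≤-trans (≮⇒≥ k≮K) (≤-trans (m≤n+m k c) (chain-conductor-≥ ch Λ Cᵢ≈Λ Λ-cond k))
    ...   | no p∤cond = trans (T.frob-∤ k p∤cond) (trans same-cond (sym (T′.frob-∤ k (p∤cond ∘ subst (p ∣_) (sym same-cond)))))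

  same-bits⇒SameChain : ∀ {ch ch′} (l : LiesIn Λ ch) (l′ : LiesIn Λ ch′) →
    funToFin (Through.bits ch (proj₂ l)) ≡ funToFin (Through.bits ch′ (proj₂ l′)) → SameChain ch ch′
  same-bits⇒SameChain {ch} {ch′} (i , Cᵢ≈Λ) (i′ , C′ᵢ′≈Λ) same-code
    with chain-index-unique ch ch′ i i′ (≈-trans {chainAt ch i} {Λ} {chainAt ch′ i′} Cᵢ≈Λ (≈-sym {chainAt ch′ i′} {Λ} C′ᵢ′≈Λ))
  ... | refl = same-offsets⇒SameChain ch ch′ Cᵢ≈Λ C′ᵢ′≈Λ same-offset
    where
    module T  = Through ch Cᵢ≈Λ
    module T′ = Through ch′ C′ᵢ′≈Λ
    same-offset : ∀ j → T.offset (toℕ j) ≡ T′.offset (toℕ j)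
    same-offset j = begin
      T.offset (toℕ j)   ≡⟨ sym (toℕ-fromℕ< (T.offset<2 (toℕ j))) ⟩
      toℕ (T.bits j)     ≡⟨ cong toℕ same-bit ⟩
      toℕ (T′.bits j)    ≡⟨ toℕ-fromℕ< (T′.offset<2 (toℕ j)) ⟩
      T′.offset (toℕ j)  ∎
      where
      open ≡-Reasoning
      same-bit = trans (sym (finToFun-funToFin T.bits j))
                       (trans (cong (λ code → finToFun code j) same-code) (finToFun-funToFin T′.bits j))

  ¬LiesInInfinitelyManyChains : ¬ LiesInInfinitelyManyChains Λ
  ¬LiesInInfinitelyManyChains (f , lies , distinct) with pigeonhole (n<1+n (2 ^ K)) (code ∘ toℕ)
    where code = λ k → funToFin (Through.bits (f k) (proj₂ (lies k)))
  ... | x , y , x<y , same-code = distinct (toℕ x) (toℕ y) (<⇒≢ x<y) (same-bits⇒SameChain (lies (toℕ x)) (lies (toℕ y)) same-code)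

¬Prime⇒LiesInInfinitelyManyChains : ∀ {Λ c} → IsConductor Λ c → gcdList (elemsBelow Λ c) ≢ 1 →
                                    ¬ Prime (gcdList (elemsBelow Λ c)) → LiesInInfinitelyManyChains Λ
¬Prime⇒LiesInInfinitelyManyChains {Λ} Λ-cond gcd≢1 ¬prime with composite-factorization _ gcd≢1 ¬prime
... | a , b , 2≤a , 2≤b , ab∣d = ManyChains.liesInInfinitelyManyChains Λ Λ-cond 2≤a 2≤b ab∣d

mainTheorem8 : (Λ : NumericalSemigroup) (c : ℕ) → IsConductor Λ c →
    (LiesInSomeChain Λ ⇔ (gcdList (elemsBelow Λ c) ≢ 1)) ×
    (gcdList (elemsBelow Λ c) ≡ 1 →
      Σ NumericalSemigroup λ S →
        Descendant Λ S ×
        (∀ n → (mem S n ≡ true) ⇔ Generated (elemsBelow Λ c) n) ×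
        (∀ D → Descendant Λ D →
          (genus D ≤ genus S) × (genus D ≡ genus S → D ≈ S))) ×
    (gcdList (elemsBelow Λ c) ≢ 1 →
      (LiesInInfinitelyManyChains Λ ⇔ (¬ Prime (gcdList (elemsBelow Λ c)))))
mainTheorem8 Λ c Λ-cond =
  mk⇔ (LiesInSomeChain⇒gcd≢1 {Λ} Λ-cond) (gcd≢1⇒LiesInSomeChain {Λ} Λ-cond) ,
  (λ gcd≡1 → let open MaximalDescendant Λ Λ-cond gcd≡1 in S , S-descendant , S-mem⇔ , S-maximal) ,
  (λ gcd≢1 → mk⇔ (λ many prime → PrimeGcd.¬LiesInInfinitelyManyChains Λ Λ-cond prime many)
                 (¬Prime⇒LiesInInfinitelyManyChains {Λ} Λ-cond gcd≢1))
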